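{- Let $k$ be a positive integer and let the triangle $uvwu$ bound the outer face of $\mathrm{Tr}(9k+2)$. Suppose $\sigma:E(\mathrm{Tr}(9k+2))\to\{0,1\}$ is a 2-edge-coloring such that all edges incident with $u$ receive the same color, and there is no monochromatic $C_4$ containing $u$. Then $\mathrm{Tr}(9k+2)$ contains a monochromatic copy of $J_k$ whose center is $v$.
   Context: The iterated triangulation $\mathrm{Tr}(n)$ is the plane graph defined recursively: $\mathrm{Tr}(0)\cong K_3$ is the plane triangle; for $i\ge 0$, $\mathrm{Tr}(i+1)$ is obtained from $\mathrm{Tr}(i)$ by placing a new vertex inside each inner face of $\mathrm{Tr}(i)$ and joining it by edges to the three vertices on the boundary of that face; the outer face of $\mathrm{Tr}(n)$ is bounded by the triangle $\mathrm{Tr}(0)$. A flower $F_k$ is a collection of $k$ copies of $C_4$ sharing exactly one common vertex, called the center. A jellyfish $J_k$ is obtained from $F_k$ and a $k$-ary tree of radius two (rooted tree whose root has $k$ children, each of which has $k$ children) by identifying the center of $F_k$ with the root of the tree; this common vertex is the center of $J_k$. A subgraph is monochromatic if all its edges receive the same color. -}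

module Defs where

open import Data.Nat using (ℕ; _<_)
open import Data.Fin using (Fin; zero; suc)
open import Data.List using (List; []; _∷_; length)
open import Data.Bool using (Bool)
open import Data.Unit using (⊤)
open import Data.Product using (Σ; _×_; _,_; ∃; ∃-syntax)
open import Data.Sum using (_⊎_)
open import Relation.Binary.PropositionalEquality using (_≡_; _≢_)
open import Relation.Nullary using (¬_)
open import Function.Definitions using (Injective)

-- Vertices: the three outer vertices  out 0, out 1, out 2  (the triangle
-- Tr(0)), and one inner vertex  inn l  for every inner face of some Tr(i),
-- i < n.  A face of Tr(i) is addressed by a list l of length i of child
-- indices (head = most recent subdivision step); the vertex placed inside
-- face l in the step Tr(i) -> Tr(i+1) is  inn l.

data V : Set where
  out : Fin 3 → V
  inn : List (Fin 3) → V

Tri : Set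
Tri = V × V × V

child : Tri → V → Fin 3 → Tri
child (a , b , c) x zero             = (x , b , c)
child (a , b , c) x (suc zero)       = (a , x , c)
child (a , b , c) x (suc (suc zero)) = (a , b , x)

corners : List (Fin 3) → Tri
corners []      = (out zero , out (suc zero) , out (suc (suc zero)))
corners (i ∷ l) = child (corners l) (inn l) i

Corner : List (Fin 3) → V → Set
Corner l x with corners l
... | (a , b , c) = x ≡ a ⊎ x ≡ b ⊎ x ≡ c

InTr : ℕ → V → Set
InTr n (out i) = ⊤
InTr n (inn l) = length l < n

data Edge (n : ℕ) : V → V → Set where
  outer : {i j : Fin 3} → i ≢ j → Edge n (out i) (out j)
  down  : {l : List (Fin 3)} {x : V} → length l < n → Corner l x → Edge n (inn l) x
  up    : {l : List (Fin 3)} {x : V} → length l < n → Corner l x → Edge n x (inn l)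

-- 2-edge-colourings: a symmetric function on pairs of vertices; only its
-- values on edges of Tr(n) matter.

Colouring : Set
Colouring = V → V → Bool

Symmetric : Colouring → Set
Symmetric σ = ∀ x y → σ x y ≡ σ y x

IncidentMono : ℕ → Colouring → V → Set
IncidentMono n σ u = ∃[ c ] (∀ x → Edge n u x → σ u x ≡ c)

MonoC4Through : ℕ → Colouring → V → Set
MonoC4Through n σ u =
  Σ V λ b → Σ V λ c → Σ V λ d → Σ Bool λ col →
    (u ≢ b) × (u ≢ c) × (u ≢ d) × (b ≢ c) × (b ≢ d) × (c ≢ d) ×
    Edge n u b × Edge n b c × Edge n c d × Edge n d u ×
    (σ u b ≡ col) × (σ b c ≡ col) × (σ c d ≡ col) × (σ d u ≡ col)

-- The jellyfish J_k.
-- Vertices: centre; for each petal i < k the C4  ctr - pa i - pb i - pc i - ctr;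
-- tree: children ch j (j < k) of the centre, grandchildren gc j m (m < k).

data JV (k : ℕ) : Set where
  ctr : JV k
  pa pb pc ch : Fin k → JV k
  gc : Fin k → Fin k → JV k

data JEdge (k : ℕ) : JV k → JV k → Set where
  e-ca : (i : Fin k) → JEdge k ctr (pa i)
  e-ab : (i : Fin k) → JEdge k (pa i) (pb i)
  e-bc : (i : Fin k) → JEdge k (pb i) (pc i)
  e-cc : (i : Fin k) → JEdge k (pc i) ctr
  e-ch : (j : Fin k) → JEdge k ctr (ch j)
  e-gc : (j m : Fin k) → JEdge k (ch j) (gc j m)

MonoJellyfish : ℕ → Colouring → ℕ → V → Set
MonoJellyfish n σ k z =
  Σ (JV k → V) λ f → Σ Bool λ col →
    Injective _≡_ _≡_ f × (f ctr ≡ z) × (∀ a → InTr n (f a)) ×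
    (∀ {a b} → JEdge k a b → Edge n (f a) (f b) × (σ (f a) (f b) ≡ col))

-- All edges at u are red, so no vertex b ≠ u is joined by two red edges to two
-- distinct neighbours x, y of u: u x b y would be a red C4.  Let w be the third
-- outer vertex and Y 0, Y 1, … the vertices placed successively in the faces
-- u v Y (m − 1); they form a path, each adjacent to u and v.  At most one of them
-- sees v in red, so 4k consecutive ones, starting at 0 or at 4k, see v in blue.
-- Split them into k quadruples Y₀ Y₁ Y₂ Y₃.  Y₀ is a tree child of v; its leaves
-- are chosen among the k + 1 vertices stacked in the faces at the edge u Y₀, at
-- most one of which sees Y₀ in red.  The petal is v Y₁ Y₂ Y₃ if both spine edges
-- are blue; otherwise it is v Yᵢ D Yᵢ₊₁ for a red edge Yᵢ Yᵢ₊₁, where D is the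
-- vertex of the face u Yᵢ Yᵢ₊₁, whose edges to Yᵢ and Yᵢ₊₁ are blue by the same
-- argument.
-- All vertices used have depth below 9k + 2.
module Submission where

open import Defs
open import Data.Bool using (Bool; not)
open import Data.Bool.Properties using (¬-not) renaming (_≟_ to _≟ᴮ_)
open import Data.Fin using (Fin; toℕ; combine; punchIn)
open import Data.Fin.Patterns using (0F; 1F; 2F; 3F)
open import Data.Fin.Properties
  using (toℕ<n; toℕ-injective; toℕ-combine; combine-injective; punchIn-injective; punchInᵢ≢i; any?)
open import Data.List using (List; []; _∷_; length; replicate; _++_)
open import Data.List.Properties using (length-replicate; ∷-injective)
open import Data.Nat using (ℕ; zero; suc; _+_; _*_; _≤_; _<_; _≥_; z≤n)
open import Data.Nat.Properties
open import Data.Nat.Tactic.RingSolver using (solve-∀)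
open import Data.Product using (Σ-syntax; _×_; _,_; proj₁; proj₂)
open import Data.Sum using (inj₁; inj₂)
open import Data.Unit using (tt)
open import Function using (_∘_)
open import Function.Definitions using (Injective)
open import Relation.Binary.PropositionalEquality
open import Relation.Nullary using (¬_; yes; no; contradiction)
open import Relation.Unary using (Decidable)

corner : Tri → Fin 3 → V
corner (a , _ , _) 0F = a
corner (_ , b , _) 1F = b
corner (_ , _ , c) 2F = c

Corner-corner : (l : List (Fin 3)) (q : Fin 3) → Corner l (corner (corners l) q)
Corner-corner l 0F = inj₁ refl
Corner-corner l 1F = inj₂ (inj₁ refl)
Corner-corner l 2F = inj₂ (inj₂ refl)

corner-root : (q : Fin 3) → corner (corners []) q ≡ out q
corner-root 0F = refl
corner-root 1F = refl
corner-root 2F = refl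

corner-child : (t : Tri) (x : V) (i : Fin 3) → corner (child t x i) i ≡ x
corner-child t x 0F = refl
corner-child t x 1F = refl
corner-child t x 2F = refl

corner-child-≢ : ∀ {t x} {i j : Fin 3} → i ≢ j → corner (child t x i) j ≡ corner t j
corner-child-≢ {i = 0F} {0F} i≢j = contradiction refl i≢j
corner-child-≢ {i = 0F} {1F} _   = refl
corner-child-≢ {i = 0F} {2F} _   = refl
corner-child-≢ {i = 1F} {0F} _   = refl
corner-child-≢ {i = 1F} {1F} i≢j = contradiction refl i≢j
corner-child-≢ {i = 1F} {2F} _   = refl
corner-child-≢ {i = 2F} {0F} _   = refl
corner-child-≢ {i = 2F} {1F} _   = refl
corner-child-≢ {i = 2F} {2F} i≢j = contradiction refl i≢j

Edge-to-corner : ∀ {n l x} (q : Fin 3) → length l < n → corner (corners l) q ≡ x → Edge n (inn l) x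
Edge-to-corner {l = l} q l<n refl = down l<n (Corner-corner l q)

Edge-sym : ∀ {n x y} → Edge n x y → Edge n y x
Edge-sym (outer i≢j)  = outer (i≢j ∘ sym)
Edge-sym (down l<n c) = up l<n c
Edge-sym (up l<n c)   = down l<n c

out-injective : ∀ {i j} → out i ≡ out j → i ≡ j
out-injective refl = refl

inn-injective : ∀ {l l′} → inn l ≡ inn l′ → l ≡ l′
inn-injective refl = refl

third : (u v : Fin 3) → u ≢ v → Σ[ w ∈ Fin 3 ] w ≢ u × w ≢ v
third 0F 0F u≢v = contradiction refl u≢v
third 0F 1F _   = 2F , (λ ()) , (λ ())
third 0F 2F _   = 1F , (λ ()) , (λ ())
third 1F 0F _   = 2F , (λ ()) , (λ ())
third 1F 1F u≢v = contradiction refl u≢v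
third 1F 2F _   = 0F , (λ ()) , (λ ())
third 2F 0F _   = 1F , (λ ()) , (λ ())
third 2F 1F _   = 0F , (λ ()) , (λ ())
third 2F 2F u≢v = contradiction refl u≢v

-- Y m lies in the face u v Y (m − 1), and Z j c in the face u (Y c) Z (j − 1) c,
-- where Y (−1) is the outer vertex w and Z (−1) c is Y (c − 1).
module Spine {u v w : Fin 3} (w≢u : w ≢ u) (w≢v : w ≢ v) (v≢u : v ≢ u) where

  spine : ℕ → List (Fin 3)
  spine m = replicate m w

  fan : ℕ → ℕ → List (Fin 3)
  fan j c = replicate j w ++ v ∷ spine c

  Y : ℕ → V
  Y m = inn (spine m)

  Z : ℕ → ℕ → V
  Z j c = inn (fan j c)

  spine-u : ∀ m → corner (corners (spine m)) u ≡ out u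
  spine-u zero    = corner-root u
  spine-u (suc m) = trans (corner-child-≢ w≢u) (spine-u m)

  spine-v : ∀ m → corner (corners (spine m)) v ≡ out v
  spine-v zero    = corner-root v
  spine-v (suc m) = trans (corner-child-≢ w≢v) (spine-v m)

  spine-w : ∀ m → corner (corners (spine (suc m))) w ≡ Y m
  spine-w m = corner-child _ _ w

  fan-u : ∀ j c → corner (corners (fan j c)) u ≡ out u
  fan-u zero    c = trans (corner-child-≢ v≢u) (spine-u c)
  fan-u (suc j) c = trans (corner-child-≢ w≢u) (fan-u j c)

  fan-v : ∀ j c → corner (corners (fan j c)) v ≡ Y c
  fan-v zero    c = corner-child _ _ v
  fan-v (suc j) c = trans (corner-child-≢ w≢v) (fan-v j c)

  fan-w : ∀ m → corner (corners (fan 0 (suc m))) w ≡ Y m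
  fan-w m = trans (corner-child-≢ (w≢v ∘ sym)) (spine-w m)

  length-fan : ∀ j c → length (fan j c) ≡ j + suc c
  length-fan zero    c = cong suc (length-replicate c)
  length-fan (suc j) c = cong suc (length-fan j c)

  module _ {n : ℕ} where

    Y-InTr : ∀ {m} → m < n → InTr n (Y m)
    Y-InTr {m} = subst (_< n) (sym (length-replicate m))

    Z-InTr : ∀ {j c} → j + suc c < n → InTr n (Z j c)
    Z-InTr {j} {c} = subst (_< n) (sym (length-fan j c))

    Yu-edge : ∀ {m} → m < n → Edge n (Y m) (out u)
    Yu-edge {m} m<n = Edge-to-corner u (Y-InTr m<n) (spine-u m)

    Yv-edge : ∀ {m} → m < n → Edge n (Y m) (out v)
    Yv-edge {m} m<n = Edge-to-corner v (Y-InTr m<n) (spine-v m)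

    YY-edge : ∀ {m} → suc m < n → Edge n (Y (suc m)) (Y m)
    YY-edge {m} m<n = Edge-to-corner w (Y-InTr m<n) (spine-w m)

    Zu-edge : ∀ {j c} → j + suc c < n → Edge n (Z j c) (out u)
    Zu-edge {j} {c} d = Edge-to-corner u (Z-InTr d) (fan-u j c)

    ZY-edge : ∀ {j c} → j + suc c < n → Edge n (Z j c) (Y c)
    ZY-edge {j} {c} d = Edge-to-corner v (Z-InTr d) (fan-v j c)

    ZY-pred-edge : ∀ {m} → suc (suc m) < n → Edge n (Z 0 (suc m)) (Y m)
    ZY-pred-edge {m} d = Edge-to-corner w (Z-InTr {0} d) (fan-w m)

  Y-injective : ∀ {m m′} → Y m ≡ Y m′ → m ≡ m′
  Y-injective {m} {m′} e = begin
    m                     ≡⟨ length-replicate m ⟨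
    length (spine m)      ≡⟨ cong length (inn-injective e) ⟩
    length (spine m′)     ≡⟨ length-replicate m′ ⟩
    m′                    ∎
    where open ≡-Reasoning

  spine≢fan : ∀ m j c → spine m ≢ fan j c
  spine≢fan zero    zero    c ()
  spine≢fan zero    (suc j) c ()
  spine≢fan (suc m) zero    c e = w≢v (proj₁ (∷-injective e))
  spine≢fan (suc m) (suc j) c e = spine≢fan m j c (proj₂ (∷-injective e))

  Y≢Z : ∀ {m j c} → Y m ≢ Z j c
  Y≢Z {m} {j} {c} = spine≢fan m j c ∘ inn-injective

  fan-injective : ∀ j c j′ c′ → fan j c ≡ fan j′ c′ → j ≡ j′ × c ≡ c′
  fan-injective zero    c zero     c′ e = refl , Y-injective (cong inn (proj₂ (∷-injective e)))
  fan-injective zero    c (suc j′) c′ e = contradiction (sym (proj₁ (∷-injective e))) w≢v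
  fan-injective (suc j) c zero     c′ e = contradiction (proj₁ (∷-injective e)) w≢v
  fan-injective (suc j) c (suc j′) c′ e with fan-injective j c j′ c′ (proj₂ (∷-injective e))
  ... | j≡j′ , c≡c′ = cong suc j≡j′ , c≡c′

  Z-injective : ∀ {j c j′ c′} → Z j c ≡ Z j′ c′ → j ≡ j′ × c ≡ c′
  Z-injective {j} {c} {j′} {c′} = fan-injective j c j′ c′ ∘ inn-injective

module RedCherry {n : ℕ} {σ : Colouring} (σ-sym : Symmetric σ) {u : V} {red : Bool}
                 (u-red : ∀ x → Edge n u x → σ u x ≡ red)
                 (no-C4 : ¬ MonoC4Through n σ u) where

  no-red-cherry : ∀ {x y b} → x ≢ y → b ≢ x → b ≢ y → u ≢ x → u ≢ y → u ≢ b →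
                  Edge n x u → Edge n y u → Edge n x b → Edge n y b →
                  σ x b ≡ red → ¬ σ y b ≡ red
  no-red-cherry {x} {y} {b} x≢y b≢x b≢y u≢x u≢y u≢b xu yu xb yb xb-red yb-red =
    no-C4 ( x , b , y , red , u≢x , u≢b , u≢y , b≢x ∘ sym , x≢y , b≢y
          , Edge-sym xu , xb , Edge-sym yb , yu
          , u-red x (Edge-sym xu) , xb-red , trans (σ-sym b y) yb-red
          , trans (σ-sym y u) (u-red y (Edge-sym yu)))

punchIn-avoiding : ∀ {N} {P : Fin (suc N) → Set} → Decidable P →
                   (∀ {i j} → i ≢ j → P i → ¬ P j) →
                   Σ[ i ∈ Fin (suc N) ] (∀ m → ¬ P (punchIn i m))
punchIn-avoiding P? at-most-one with any? P?
... | yes (i , Pi) = i , λ m → at-most-one (punchInᵢ≢i i m ∘ sym) Pi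
... | no ¬∃P       = 0F , λ m Pm → ¬∃P (punchIn 0F m , Pm)

block-avoiding : ∀ N {P : ℕ → Set} → Decidable P →
                 (∀ {i j} → i < N + N → j < N + N → i ≢ j → P i → ¬ P j) →
                 Σ[ s ∈ ℕ ] s ≤ N × (∀ (i : Fin N) → ¬ P (toℕ i + s))
block-avoiding N {P} P? at-most-one with any? (P? ∘ toℕ {N})
... | yes (i₀ , Pi₀) = N , ≤-refl , λ i →
  at-most-one (<-≤-trans (toℕ<n i₀) (m≤m+n N N)) (+-monoˡ-< N (toℕ<n i))
              (<⇒≢ (<-≤-trans (toℕ<n i₀) (m≤n+m N (toℕ i)))) Pi₀
... | no ¬∃P = 0 , z≤n , λ i Pi → ¬∃P (i , subst P (+-identityʳ (toℕ i)) Pi)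

fan-depth< : ∀ {k j i s} → j ≤ suc k → i < k * 4 → s ≤ k * 4 → j + suc (i + s) < 9 * k + 2
fan-depth< {k} {j} {i} {s} j≤ i< s≤ = begin-strict
  j + (suc i + s)          ≤⟨ +-mono-≤ j≤ (+-mono-≤ i< s≤) ⟩
  suc k + (k * 4 + k * 4)  ≡⟨ regroup k ⟩
  9 * k + 1                <⟨ +-monoʳ-< (9 * k) ≤-refl ⟩
  9 * k + 2                ∎
  where
  open ≤-Reasoning
  regroup : ∀ k → suc k + (k * 4 + k * 4) ≡ 9 * k + 1
  regroup = solve-∀

double-block< : ∀ {k i} → i < k * 4 + k * 4 → i < 9 * k + 2
double-block< {k} i< = <-≤-trans i< (begin
  k * 4 + k * 4            ≤⟨ m≤m+n _ (k + 2) ⟩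
  k * 4 + k * 4 + (k + 2)  ≡⟨ regroup k ⟩
  9 * k + 2                ∎)
  where
  open ≤-Reasoning
  regroup : ∀ k → k * 4 + k * 4 + (k + 2) ≡ 9 * k + 2
  regroup = solve-∀

module Construction (k : ℕ) {u v w : Fin 3} (w≢u : w ≢ u) (w≢v : w ≢ v) (v≢u : v ≢ u)
                    {σ : Colouring} (σ-sym : Symmetric σ) {red : Bool}
                    (u-red : ∀ x → Edge (9 * k + 2) (out u) x → σ (out u) x ≡ red)
                    (no-C4 : ¬ MonoC4Through (9 * k + 2) σ (out u)) where

  open Spine w≢u w≢v v≢u
  open RedCherry σ-sym u-red no-C4

  n : ℕ
  n = 9 * k + 2

  blue : Bool
  blue = not red

  BlueEdge : V → V → Set
  BlueEdge x y = Edge n x y × σ x y ≡ blue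

  BlueEdge-sym : ∀ {x y} → BlueEdge x y → BlueEdge y x
  BlueEdge-sym {x} {y} (xy , xy-blue) = Edge-sym xy , trans (σ-sym y x) xy-blue

  v-red-at-most-one : ∀ {i j} → i < n → j < n → i ≢ j →
                      σ (out v) (Y i) ≡ red → ¬ σ (out v) (Y j) ≡ red
  v-red-at-most-one i<n j<n i≢j vi-red vj-red =
    no-red-cherry (i≢j ∘ Y-injective) (λ ()) (λ ()) (λ ()) (λ ()) (v≢u ∘ sym ∘ out-injective)
                  (Yu-edge i<n) (Yu-edge j<n) (Yv-edge i<n) (Yv-edge j<n)
                  (trans (σ-sym _ _) vi-red) (trans (σ-sym _ _) vj-red)

  v-blue-block : Σ[ s ∈ ℕ ] s ≤ k * 4 × (∀ (i : Fin (k * 4)) → σ (out v) (Y (toℕ i + s)) ≡ blue)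
  v-blue-block =
    let s , s≤ , not-red = block-avoiding (k * 4) (λ i → σ (out v) (Y i) ≟ᴮ red)
                             (λ i< j< → v-red-at-most-one (double-block< {k} i<) (double-block< {k} j<))
    in s , s≤ , ¬-not ∘ not-red

  fan-red-at-most-one : ∀ {c j j′} → j + suc c < n → j′ + suc c < n → j ≢ j′ →
                        σ (Z j c) (Y c) ≡ red → ¬ σ (Z j′ c) (Y c) ≡ red
  fan-red-at-most-one d d′ j≢j′ =
    no-red-cherry (j≢j′ ∘ proj₁ ∘ Z-injective) Y≢Z Y≢Z (λ ()) (λ ()) (λ ())
                  (Zu-edge d) (Zu-edge d′) (ZY-edge d) (ZY-edge d′)

  detour-blue : ∀ {m} → suc (suc m) < n → σ (Y m) (Y (suc m)) ≡ red →
                BlueEdge (Y m) (Z 0 (suc m)) × BlueEdge (Z 0 (suc m)) (Y (suc m))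
  detour-blue {m} d red-step =
      BlueEdge-sym (ZY-pred-edge d , ¬-not (no-red-cherry Y≢D Y≢successor Y≢D (λ ()) (λ ()) (λ ())
                      (Yu-edge d′) (Zu-edge {j = 0} d) (YY-edge d′) (ZY-pred-edge d)
                      (trans (σ-sym _ _) red-step)))
    , (ZY-edge {j = 0} d , ¬-not (no-red-cherry Y≢D (Y≢successor ∘ sym) Y≢D (λ ()) (λ ()) (λ ())
                      (Yu-edge (<-trans (n<1+n m) d′)) (Zu-edge {j = 0} d) (Edge-sym (YY-edge d′))
                      (ZY-edge {j = 0} d) red-step))
    where
    d′ : suc m < n
    d′ = <-trans (n<1+n _) d
    Y≢successor : Y m ≢ Y (suc m)
    Y≢successor = 1+n≢n ∘ sym ∘ Y-injective
    Y≢D : ∀ {i} → Y i ≢ Z 0 (suc m)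
    Y≢D = Y≢Z {j = 0}

  module Embedding (s : ℕ) (s≤ : s ≤ k * 4)
                   (v-blue : ∀ (i : Fin (k * 4)) → σ (out v) (Y (toℕ i + s)) ≡ blue) where

    slot : Fin k → Fin 4 → ℕ
    slot t r = toℕ r + 4 * toℕ t + s

    slot≡combine : ∀ t r → slot t r ≡ toℕ (combine t r) + s
    slot≡combine t r = cong (_+ s) (trans (+-comm (toℕ r) (4 * toℕ t)) (sym (toℕ-combine t r)))

    slot-injective : ∀ {t r t′ r′} → slot t r ≡ slot t′ r′ → t ≡ t′ × r ≡ r′
    slot-injective {t} {r} {t′} {r′} e = combine-injective t r t′ r′ (toℕ-injective
      (+-cancelʳ-≡ s _ _ (trans (sym (slot≡combine t r)) (trans e (slot≡combine t′ r′)))))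

    slot-depth< : ∀ {j} t r → j ≤ suc k → j + suc (slot t r) < n
    slot-depth< {j} t r j≤ = subst (λ m → j + suc m < n) (sym (slot≡combine t r))
                                   (fan-depth< j≤ (toℕ<n (combine t r)) s≤)

    slot< : ∀ t r → slot t r < n
    slot< t r = <-trans (n<1+n _) (slot-depth< t r z≤n)

    spoke : ∀ t r → BlueEdge (out v) (Y (slot t r))
    spoke t r = Edge-sym (Yv-edge (slot< t r))
              , subst (λ m → σ (out v) (Y m) ≡ blue) (sym (slot≡combine t r)) (v-blue (combine t r))

    branch : Fin k → ℕ
    branch t = slot t 0F

    leaf-depth< : ∀ t (j : Fin (suc k)) → suc (toℕ j) + suc (branch t) < n
    leaf-depth< t j = slot-depth< t 0F (toℕ<n j)

    -- Leaves are taken among Z (suc j) _ because the vertices Z 0 _ serve as detours.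
    -- Opaque so that the injectivity proof below does not unfold the search.
    opaque
      leaf-choice : (t : Fin k) →
                    Σ[ i ∈ Fin (suc k) ] ∀ m →
                      ¬ σ (Z (suc (toℕ (punchIn i m))) (branch t)) (Y (branch t)) ≡ red
      leaf-choice t = punchIn-avoiding (λ j → σ (Z (suc (toℕ j)) (branch t)) (Y (branch t)) ≟ᴮ red)
        (λ {j} {j′} j≢j′ → fan-red-at-most-one (leaf-depth< t j) (leaf-depth< t j′)
                                                (j≢j′ ∘ toℕ-injective ∘ suc-injective))

    leaf-index : Fin k → Fin k → ℕ
    leaf-index t m = suc (toℕ (punchIn (proj₁ (leaf-choice t)) m))

    leaf : Fin k → Fin k → V
    leaf t m = Z (leaf-index t m) (branch t)

    twig : ∀ t m → BlueEdge (Y (branch t)) (leaf t m)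
    twig t m = BlueEdge-sym ( ZY-edge {j = leaf-index t m} (leaf-depth< t _)
                           , ¬-not (proj₂ (leaf-choice t) m))

    data Petal (t : Fin k) : Set where
      detour₁₂ : σ (Y (slot t 1F)) (Y (slot t 2F)) ≡ red → Petal t
      detour₂₃ : σ (Y (slot t 2F)) (Y (slot t 3F)) ≡ red → Petal t
      path₁₂₃  : σ (Y (slot t 1F)) (Y (slot t 2F)) ≡ blue → σ (Y (slot t 2F)) (Y (slot t 3F)) ≡ blue →
                 Petal t

    petal : (t : Fin k) → Petal t
    petal t with σ (Y (slot t 1F)) (Y (slot t 2F)) ≟ᴮ red | σ (Y (slot t 2F)) (Y (slot t 3F)) ≟ᴮ red
    ... | yes red₁₂  | _          = detour₁₂ red₁₂
    ... | no  _      | yes red₂₃  = detour₂₃ red₂₃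
    ... | no  blue₁₂ | no  blue₂₃ = path₁₂₃ (¬-not blue₁₂) (¬-not blue₂₃)

    -- decode ∘ encode is the identity, so the embedding is injective once realize is.
    data Code : Set where
      centre   : Code
      spine-at : Fin k → Fin 4 → Code
      detour   : Fin k → Fin 4 → Code
      leaf-at  : Fin k → Fin k → Code

    realize : Code → V
    realize centre         = out v
    realize (spine-at t r) = Y (slot t r)
    realize (detour t r)   = Z 0 (slot t r)
    realize (leaf-at t m)  = leaf t m

    first-slot last-slot : ∀ {t} → Petal t → Fin 4
    first-slot (detour₁₂ _)  = 1F
    first-slot (detour₂₃ _)  = 2F
    first-slot (path₁₂₃ _ _) = 1F
    last-slot (detour₁₂ _)   = 2F
    last-slot (detour₂₃ _)   = 3F
    last-slot (path₁₂₃ _ _)  = 3F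

    middle : ∀ {t} → Petal t → Code
    middle {t} (detour₁₂ _)  = detour t 2F
    middle {t} (detour₂₃ _)  = detour t 3F
    middle {t} (path₁₂₃ _ _) = spine-at t 2F

    petal-edges : ∀ {t} (p : Petal t) → BlueEdge (Y (slot t (first-slot p))) (realize (middle p))
                                       × BlueEdge (realize (middle p)) (Y (slot t (last-slot p)))
    petal-edges {t} (detour₁₂ red₁₂) = detour-blue (slot-depth< t 2F z≤n) red₁₂
    petal-edges {t} (detour₂₃ red₂₃) = detour-blue (slot-depth< t 3F z≤n) red₂₃
    petal-edges {t} (path₁₂₃ blue₁₂ blue₂₃) =
        (Edge-sym (YY-edge (slot-depth< t 1F z≤n)) , blue₁₂)
      , (Edge-sym (YY-edge (slot-depth< t 2F z≤n)) , blue₂₃)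

    encode : JV k → Code
    encode ctr      = centre
    encode (pa t)   = spine-at t (first-slot (petal t))
    encode (pb t)   = middle (petal t)
    encode (pc t)   = spine-at t (last-slot (petal t))
    encode (ch t)   = spine-at t 0F
    encode (gc t m) = leaf-at t m

    role-of-second : ∀ {t} → Petal t → JV k
    role-of-second {t} (detour₁₂ _)  = pc t
    role-of-second {t} (detour₂₃ _)  = pa t
    role-of-second {t} (path₁₂₃ _ _) = pb t

    decode : Code → JV k
    decode centre          = ctr
    decode (spine-at t 0F) = ch t
    decode (spine-at t 1F) = pa t
    decode (spine-at t 2F) = role-of-second (petal t)
    decode (spine-at t 3F) = pc t
    decode (detour t _)    = pb t
    decode (leaf-at t m)   = gc t m

    decode-encode : ∀ x → decode (encode x) ≡ x
    decode-encode ctr = refl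
    decode-encode (pa t) with petal t in eq
    ... | detour₁₂ _  = refl
    ... | detour₂₃ _  rewrite eq = refl
    ... | path₁₂₃ _ _ = refl
    decode-encode (pb t) with petal t in eq
    ... | detour₁₂ _  = refl
    ... | detour₂₃ _  = refl
    ... | path₁₂₃ _ _ rewrite eq = refl
    decode-encode (pc t) with petal t in eq
    ... | detour₁₂ _  rewrite eq = refl
    ... | detour₂₃ _  = refl
    ... | path₁₂₃ _ _ = refl
    decode-encode (ch t)   = refl
    decode-encode (gc t m) = refl

    realize-injective : Injective _≡_ _≡_ realize
    realize-injective {centre}         {centre}           _ = refl
    realize-injective {centre}         {spine-at _ _}     ()
    realize-injective {centre}         {detour _ _}       ()
    realize-injective {centre}         {leaf-at _ _}      ()
    realize-injective {spine-at _ _}   {centre}           ()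
    realize-injective {detour _ _}     {centre}           ()
    realize-injective {leaf-at _ _}    {centre}           ()
    realize-injective {spine-at t r}   {spine-at t′ r′}   e
      with refl , refl ← slot-injective {t} {r} {t′} {r′} (Y-injective {slot t r} e) = refl
    realize-injective {spine-at t r}   {detour t′ r′}     e =
      contradiction e (Y≢Z {slot t r} {0} {slot t′ r′})
    realize-injective {spine-at t r}   {leaf-at t′ m′}    e =
      contradiction e (Y≢Z {slot t r} {leaf-index t′ m′} {branch t′})
    realize-injective {detour t r}     {spine-at t′ r′}   e =
      contradiction (sym e) (Y≢Z {slot t′ r′} {0} {slot t r})
    realize-injective {leaf-at t m}    {spine-at t′ r′}   e =
      contradiction (sym e) (Y≢Z {slot t′ r′} {leaf-index t m} {branch t})
    realize-injective {detour t r}     {detour t′ r′}     e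
      with refl , refl ← slot-injective {t} {r} {t′} {r′}
                           (proj₂ (Z-injective {0} {slot t r} {0} {slot t′ r′} e)) = refl
    realize-injective {detour t r}     {leaf-at t′ m′}    e
      with () ← proj₁ (Z-injective {0} {slot t r} {leaf-index t′ m′} {branch t′} e)
    realize-injective {leaf-at t m}    {detour t′ r′}     e
      with () ← proj₁ (Z-injective {leaf-index t m} {branch t} {0} {slot t′ r′} e)
    realize-injective {leaf-at t m}    {leaf-at t′ m′}    e
      with same-leaf , same-branch ← Z-injective {leaf-index t m} {branch t}
                                                 {leaf-index t′ m′} {branch t′} e
      with refl , _ ← slot-injective {t} {0F} {t′} {0F} same-branch
      = cong (leaf-at t) (punchIn-injective _ m m′ (toℕ-injective (suc-injective same-leaf)))

    realize-InTr : ∀ c → InTr n (realize c)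
    realize-InTr centre         = tt
    realize-InTr (spine-at t r) = Y-InTr (slot< t r)
    realize-InTr (detour t r)   = Z-InTr {j = 0} (slot-depth< t r z≤n)
    realize-InTr (leaf-at t m)  = Z-InTr {j = leaf-index t m} (leaf-depth< t _)

    embed : JV k → V
    embed = realize ∘ encode

    embed-injective : Injective _≡_ _≡_ embed
    embed-injective {x} {y} e = begin
      x                     ≡⟨ decode-encode x ⟨
      decode (encode x)     ≡⟨ cong decode (realize-injective e) ⟩
      decode (encode y)     ≡⟨ decode-encode y ⟩
      y                     ∎
      where open ≡-Reasoning

    embed-edge : ∀ {a b} → JEdge k a b → BlueEdge (embed a) (embed b)
    embed-edge (e-ca t)   = spoke t (first-slot (petal t))
    embed-edge (e-ab t)   = proj₁ (petal-edges (petal t))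
    embed-edge (e-bc t)   = proj₂ (petal-edges (petal t))
    embed-edge (e-cc t)   = BlueEdge-sym (spoke t (last-slot (petal t)))
    embed-edge (e-ch t)   = spoke t 0F
    embed-edge (e-gc t m) = twig t m

    jellyfish : MonoJellyfish n σ k (out v)
    jellyfish = embed , blue , embed-injective , refl , realize-InTr ∘ encode , embed-edge

lemma4p4 : (k : ℕ) → k ≥ 1 → (u v : Fin 3) → u ≢ v →
    (σ : Colouring) → Symmetric σ →
    IncidentMono (9 * k + 2) σ (out u) →
    ¬ MonoC4Through (9 * k + 2) σ (out u) →
    MonoJellyfish (9 * k + 2) σ k (out v)
lemma4p4 k _ u v u≢v σ σ-sym (red , u-red) no-C4 =
  let w , w≢u , w≢v = third u v u≢v
      open Construction k w≢u w≢v (u≢v ∘ sym) σ-sym u-red no-C4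
      s , s≤ , v-blue = v-blue-block
  in Embedding.jellyfish s s≤ v-blue
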